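{- Let $n\ge 1$ and let $G_n^0$ be the monoid presented by generators $\pi_1,\dots,\pi_{n-1},P_1,\dots,P_n$ and relations $\pi_i^2=\pi_i$ ($1\le i\le n-1$); $\pi_i\pi_{i+1}\pi_i=\pi_{i+1}\pi_i\pi_{i+1}$ ($1\le i\le n-2$); $\pi_i\pi_j=\pi_j\pi_i$ ($|i-j|\ge 2$); $P_i^2=P_i$ ($1\le i\le n$); $P_iP_j=P_jP_i$ ($1\le i,j\le n$); $P_i\pi_j=\pi_jP_i$ ($i<j$); $P_i\pi_j=\pi_jP_i=P_i$ ($j<i$); $P_{i+1}=P_i\pi_iP_i$ ($1\le i<n$). Then, setting $\pi_0\eqdef P_1$, the monoid $G_n^0$ is generated by $\pi_0,\pi_1,\dots,\pi_{n-1}$ and is presented by these generators subject only to the relations $\pi_i^2=\pi_i$ ($0\le i\le n-1$); $\pi_i\pi_{i+1}\pi_i=\pi_{i+1}\pi_i\pi_{i+1}$ ($1\le i\le n-2$); $\pi_1\pi_0\pi_1\pi_0=\pi_0\pi_1\pi_0=\pi_0\pi_1\pi_0\pi_1$; $\pi_i\pi_j=\pi_j\pi_i$ ($0\le i,j\le n-1$, $|i-j|\ge 2$). -}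

module Defs where

open import Data.Nat using (ℕ; zero; suc; _≤_; _<_; ∣_-_∣)
open import Data.Fin using (Fin; toℕ) renaming (zero to fzero; suc to fsuc)
open import Data.List using (List; []; _∷_; _++_; map)
open import Data.Product using (Σ; _×_)
open import Relation.Binary.PropositionalEquality using (_≡_)

module _ {X : Set} (R : List X → List X → Set) where
  data Cong : List X → List X → Set where
    rel   : ∀ {u v} → R u v → Cong u v
    c-refl  : ∀ {u} → Cong u u
    c-sym   : ∀ {u v} → Cong u v → Cong v u
    c-trans : ∀ {u v w} → Cong u v → Cong v w → Cong u w
    c-ctx   : ∀ {u v} (a b : List X) → Cong u v → Cong (a ++ u ++ b) (a ++ v ++ b)

-- Throughout, the paper's n is  suc m  (so n ≥ 1).

-- Generators of G_n^0:  π k  (k : Fin m) stands for π_{k+1}  (1 ≤ k+1 ≤ n-1),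
--                        P k  (k : Fin n) stands for P_{k+1}  (1 ≤ k+1 ≤ n).
data GenG (m : ℕ) : Set where
  π : Fin m → GenG m
  P : Fin (suc m) → GenG m

data RelG (m : ℕ) : List (GenG m) → List (GenG m) → Set where
  π-idem  : ∀ i → RelG m (π i ∷ π i ∷ []) (π i ∷ [])
  π-braid : ∀ i j → toℕ j ≡ suc (toℕ i) →
            RelG m (π i ∷ π j ∷ π i ∷ []) (π j ∷ π i ∷ π j ∷ [])
  π-comm  : ∀ i j → 2 ≤ ∣ toℕ i - toℕ j ∣ →
            RelG m (π i ∷ π j ∷ []) (π j ∷ π i ∷ [])
  P-idem  : ∀ i → RelG m (P i ∷ P i ∷ []) (P i ∷ [])
  P-comm  : ∀ i j → RelG m (P i ∷ P j ∷ []) (P j ∷ P i ∷ [])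
  Pπ-comm : ∀ i j → toℕ i < toℕ j → RelG m (P i ∷ π j ∷ []) (π j ∷ P i ∷ [])
  Pπ-absl : ∀ i j → toℕ j < toℕ i → RelG m (P i ∷ π j ∷ []) (P i ∷ [])
  πP-absr : ∀ i j → toℕ j < toℕ i → RelG m (π j ∷ P i ∷ []) (P i ∷ [])
  P-step  : ∀ i i' j → toℕ i' ≡ suc (toℕ i) → toℕ j ≡ toℕ i →
            RelG m (P i' ∷ []) (P i ∷ π j ∷ P i ∷ [])

_≈G_ : ∀ {m} → List (GenG m) → List (GenG m) → Set
_≈G_ {m} = Cong (RelG m)

-- Second presentation: generators σ k (k : Fin n) standing for π_k, 0 ≤ k ≤ n-1.
data GenH (m : ℕ) : Set where
  σ : Fin (suc m) → GenH m

data RelH (m : ℕ) : List (GenH m) → List (GenH m) → Set where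
  idem   : ∀ i → RelH m (σ i ∷ σ i ∷ []) (σ i ∷ [])
  braid  : ∀ i j → 1 ≤ toℕ i → toℕ j ≡ suc (toℕ i) →
           RelH m (σ i ∷ σ j ∷ σ i ∷ []) (σ j ∷ σ i ∷ σ j ∷ [])
  rel01a : ∀ z o → toℕ z ≡ 0 → toℕ o ≡ 1 →
           RelH m (σ o ∷ σ z ∷ σ o ∷ σ z ∷ []) (σ z ∷ σ o ∷ σ z ∷ [])
  rel01b : ∀ z o → toℕ z ≡ 0 → toℕ o ≡ 1 →
           RelH m (σ z ∷ σ o ∷ σ z ∷ []) (σ z ∷ σ o ∷ σ z ∷ σ o ∷ [])
  comm   : ∀ i j → 2 ≤ ∣ toℕ i - toℕ j ∣ →
           RelH m (σ i ∷ σ j ∷ []) (σ j ∷ σ i ∷ [])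

_≈H_ : ∀ {m} → List (GenH m) → List (GenH m) → Set
_≈H_ {m} = Cong (RelH m)

φ : ∀ {m} → GenH m → GenG m
φ (σ fzero)    = P fzero
φ (σ (fsuc k)) = π k

φ* : ∀ {m} → List (GenH m) → List (GenG m)
φ* = map φ

-- The relation P_{k+2} = P_{k+1} π_{k+1} P_{k+1} rewrites every P_{k+1} as a word Pword k in
-- π₀,…,π_k, so P_i can be eliminated; the maps φ* and ψ* = "unfold P_{k+1} into Pword k" are then
-- inverse to each other on words. The real work is checking that the relations of G_n^0 survive
-- the unfolding. They all reduce to the absorption laws π_j Pword k = Pword k = Pword k π_j
-- (j ≤ k), proved by induction on k: for j = k + 1 the case k = 0 is exactly the relation
-- π₁π₀π₁π₀ = π₀π₁π₀ = π₀π₁π₀π₁, and for k ≥ 1 one writes Pword (k+1) = q a q b q a q with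
-- q = Pword (k-1), a = π_k, b = π_{k+1}, commutes b through q and uses a b a = b a b together
-- with the absorption laws at the two previous levels.

module Submission where

open import Defs
open import Data.Nat using (ℕ; zero; suc; _≤_; _<_; z≤n; s≤s; ∣_-_∣)
open import Data.Nat.Properties
  using (≤-refl; ≤-trans; ≤-total; ≤-pred; <⇒≤; m≤n+m; m≤n⇒m<n∨m≡n; suc-injective; m+n≤o⇒m≤o∸n; m∸n≤∣m-n∣)
open import Data.Fin using (Fin; toℕ) renaming (zero to fzero; suc to fsuc)
open import Data.Fin.Properties using (toℕ≤pred[n])
open import Data.List using (List; []; _∷_; _++_; [_]; map; concat; concatMap)
open import Data.List.Properties
  using (map-++; ++-assoc; ++-identityʳ; concat-++; concatMap-map; concatMap-cong; concatMap-pure)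
open import Data.Product using (Σ; _×_; _,_)
open import Data.Sum using (inj₁; inj₂)
open import Function using (_∘_)
open import Level using (0ℓ)
open import Relation.Binary.Bundles using (Setoid)
open import Relation.Binary.PropositionalEquality
  using (_≡_; refl; sym; trans; cong; cong₂; subst; subst₂; module ≡-Reasoning)

Cong-setoid : {X : Set} → (List X → List X → Set) → Setoid 0ℓ 0ℓ
Cong-setoid {X} R = record
  { Carrier       = List X
  ; _≈_           = Cong R
  ; isEquivalence = record { refl = c-refl ; sym = c-sym ; trans = c-trans }
  }

module CongReasoning {X : Set} (R : List X → List X → Set) where

  open import Relation.Binary.Reasoning.Setoid (Cong-setoid R) public

  ≡⇒Cong : ∀ {u v} → u ≡ v → Cong R u v
  ≡⇒Cong refl = c-refl

  Cong-++ˡ : ∀ (a : List X) {u v} → Cong R u v → Cong R (a ++ u) (a ++ v)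
  Cong-++ˡ a {u} {v} p =
    subst₂ (λ x y → Cong R (a ++ x) (a ++ y)) (++-identityʳ u) (++-identityʳ v) (c-ctx a [] p)

  Cong-++ʳ : ∀ (b : List X) {u v} → Cong R u v → Cong R (u ++ b) (v ++ b)
  Cong-++ʳ b = c-ctx [] b

  Cong-∷ : ∀ x {u v} → Cong R u v → Cong R (x ∷ u) (x ∷ v)
  Cong-∷ x = Cong-++ˡ [ x ]

  Cong-++ : ∀ {u u′ v v′} → Cong R u u′ → Cong R v v′ → Cong R (u ++ v) (u′ ++ v′)
  Cong-++ {u′ = u′} {v = v} p q = c-trans (Cong-++ʳ v p) (Cong-++ˡ u′ q)

Cong-map : ∀ {X Y : Set} {R : List X → List X → Set} {S : List Y → List Y → Set}
           (F : List X → List Y) → (∀ a b → F (a ++ b) ≡ F a ++ F b) →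
           (∀ {u v} → R u v → Cong S (F u) (F v)) →
           ∀ {u v} → Cong R u v → Cong S (F u) (F v)
Cong-map F F-++ F-rel (rel r)       = F-rel r
Cong-map F F-++ F-rel c-refl        = c-refl
Cong-map F F-++ F-rel (c-sym p)     = c-sym (Cong-map F F-++ F-rel p)
Cong-map F F-++ F-rel (c-trans p q) = c-trans (Cong-map F F-++ F-rel p) (Cong-map F F-++ F-rel q)
Cong-map {S = S} F F-++ F-rel (c-ctx {u} {v} a b p) =
  subst₂ (Cong S) (sym (F-ctx u)) (sym (F-ctx v)) (c-ctx (F a) (F b) (Cong-map F F-++ F-rel p))
  where
  F-ctx : ∀ w → F (a ++ w ++ b) ≡ F a ++ F w ++ F b
  F-ctx w = trans (F-++ a (w ++ b)) (cong (F a ++_) (F-++ w b))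

concatMap-++ : ∀ {A B : Set} (f : A → List B) xs ys →
               concatMap f (xs ++ ys) ≡ concatMap f xs ++ concatMap f ys
concatMap-++ f xs ys = trans (cong concat (map-++ f xs ys)) (sym (concat-++ (map f xs) (map f ys)))

-- Indices above m are clamped to m; every use below has index ≤ m.
clamp : ∀ m → ℕ → Fin (suc m)
clamp m       zero    = fzero
clamp zero    (suc n) = fzero
clamp (suc m) (suc n) = fsuc (clamp m n)

toℕ-clamp : ∀ m n → n ≤ m → toℕ (clamp m n) ≡ n
toℕ-clamp m       zero    _       = refl
toℕ-clamp (suc m) (suc n) (s≤s h) = cong suc (toℕ-clamp m n h)

clamp-toℕ : ∀ m (x : Fin (suc m)) → clamp m (toℕ x) ≡ x
clamp-toℕ m       fzero    = refl
clamp-toℕ (suc m) (fsuc x) = cong fsuc (clamp-toℕ m x)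

2+i≤j⇒2≤∣j-i∣ : ∀ i j → suc (suc i) ≤ j → 2 ≤ ∣ j - i ∣
2+i≤j⇒2≤∣j-i∣ i j h = ≤-trans (m+n≤o⇒m≤o∸n 2 h) (m∸n≤∣m-n∣ j i)

module Pwords (m : ℕ) where

  open CongReasoning (RelH m)

  -- s n is the paper's π_n, and Pword k the word for P_{k+1} (from P_{k+2} = P_{k+1} π_{k+1} P_{k+1}).
  s : ℕ → GenH m
  s n = σ (clamp m n)

  Pword : ℕ → List (GenH m)
  Pword zero    = [ s 0 ]
  Pword (suc k) = Pword k ++ s (suc k) ∷ Pword k

  -- Words are kept right-nested with an explicit tail r, so that unfolding a Pword is the only
  -- place where reassociation is needed.
  Pword-suc : ∀ k r → Pword (suc k) ++ r ≡ Pword k ++ s (suc k) ∷ Pword k ++ r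
  Pword-suc k r = ++-assoc (Pword k) (s (suc k) ∷ Pword k) r

  s-idem : ∀ a r → (s a ∷ s a ∷ r) ≈H (s a ∷ r)
  s-idem a r = Cong-++ʳ r (rel (idem _))

  s-braid : ∀ a → 1 ≤ a → a < m → (s a ∷ s (suc a) ∷ [ s a ]) ≈H (s (suc a) ∷ s a ∷ [ s (suc a) ])
  s-braid a 1≤a a<m = rel (braid _ _ (subst (1 ≤_) (sym toℕ-a) 1≤a) (trans toℕ-1+a (cong suc (sym toℕ-a))))
    where
    toℕ-a : toℕ (clamp m a) ≡ a
    toℕ-a = toℕ-clamp m a (<⇒≤ a<m)
    toℕ-1+a : toℕ (clamp m (suc a)) ≡ suc a
    toℕ-1+a = toℕ-clamp m (suc a) a<m

  s-comm : ∀ a b → a ≤ m → b ≤ m → 2 ≤ ∣ a - b ∣ → (s a ∷ [ s b ]) ≈H (s b ∷ [ s a ])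
  s-comm a b a≤m b≤m h =
    rel (comm _ _ (subst (2 ≤_) (cong₂ ∣_-_∣ (sym (toℕ-clamp m a a≤m)) (sym (toℕ-clamp m b b≤m))) h))

  s-comm-Pword : ∀ k j → j ≤ m → suc (suc k) ≤ j → ∀ r → (s j ∷ Pword k ++ r) ≈H (Pword k ++ s j ∷ r)
  s-comm-Pword zero    j j≤m h r = Cong-++ʳ r (s-comm j 0 j≤m z≤n (2+i≤j⇒2≤∣j-i∣ 0 j h))
  s-comm-Pword (suc k) j j≤m h r = begin
    s j ∷ Pword (suc k) ++ r                        ≡⟨ cong (s j ∷_) (Pword-suc k r) ⟩
    s j ∷ Pword k ++ s (suc k) ∷ Pword k ++ r       ≈⟨ s-comm-Pword k j j≤m h′ _ ⟩
    Pword k ++ s j ∷ s (suc k) ∷ Pword k ++ r       ≈⟨ Cong-++ˡ (Pword k) (Cong-++ʳ (Pword k ++ r) j⇄1+k) ⟩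
    Pword k ++ s (suc k) ∷ s j ∷ Pword k ++ r       ≈⟨ Cong-++ˡ (Pword k) (Cong-∷ _ (s-comm-Pword k j j≤m h′ r)) ⟩
    Pword k ++ s (suc k) ∷ Pword k ++ s j ∷ r       ≡⟨ Pword-suc k (s j ∷ r) ⟨
    Pword (suc k) ++ s j ∷ r                        ∎
    where
    h′ : suc (suc k) ≤ j
    h′ = <⇒≤ h
    j⇄1+k : (s j ∷ [ s (suc k) ]) ≈H (s (suc k) ∷ [ s j ])
    j⇄1+k = s-comm j (suc k) j≤m (≤-trans (m≤n+m (suc k) 2) (≤-trans h j≤m)) (2+i≤j⇒2≤∣j-i∣ (suc k) j h)

  Absorbsˡ Absorbsʳ : ℕ → Set
  Absorbsˡ k = ∀ j → j ≤ k → ∀ r → (s j ∷ Pword k ++ r) ≈H (Pword k ++ r)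
  Absorbsʳ k = ∀ j → j ≤ k → ∀ r → (Pword k ++ s j ∷ r) ≈H (Pword k ++ r)

  Pword-absorbsˡ : ∀ {k} → Absorbsˡ k → ∀ k′ → k′ ≤ k → ∀ r → (Pword k′ ++ Pword k ++ r) ≈H (Pword k ++ r)
  Pword-absorbsˡ ab zero     _     r = ab 0 z≤n r
  Pword-absorbsˡ {k} ab (suc k′) k′<k r = begin
    Pword (suc k′) ++ Pword k ++ r                    ≡⟨ Pword-suc k′ _ ⟩
    Pword k′ ++ s (suc k′) ∷ Pword k′ ++ Pword k ++ r ≈⟨ Cong-++ˡ (Pword k′) (Cong-∷ _ (Pword-absorbsˡ ab k′ (<⇒≤ k′<k) r)) ⟩
    Pword k′ ++ s (suc k′) ∷ Pword k ++ r             ≈⟨ Cong-++ˡ (Pword k′) (ab (suc k′) k′<k r) ⟩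
    Pword k′ ++ Pword k ++ r                          ≈⟨ Pword-absorbsˡ ab k′ (<⇒≤ k′<k) r ⟩
    Pword k ++ r                                      ∎

  Pword-absorbsʳ : ∀ {k} → Absorbsʳ k → ∀ k′ → k′ ≤ k → ∀ r → (Pword k ++ Pword k′ ++ r) ≈H (Pword k ++ r)
  Pword-absorbsʳ ab zero     _     r = ab 0 z≤n r
  Pword-absorbsʳ {k} ab (suc k′) k′<k r = begin
    Pword k ++ Pword (suc k′) ++ r                    ≡⟨ cong (Pword k ++_) (Pword-suc k′ r) ⟩
    Pword k ++ Pword k′ ++ s (suc k′) ∷ Pword k′ ++ r ≈⟨ Pword-absorbsʳ ab k′ (<⇒≤ k′<k) _ ⟩
    Pword k ++ s (suc k′) ∷ Pword k′ ++ r             ≈⟨ ab (suc k′) k′<k _ ⟩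
    Pword k ++ Pword k′ ++ r                          ≈⟨ Pword-absorbsʳ ab k′ (<⇒≤ k′<k) r ⟩
    Pword k ++ r                                      ∎

  absorbsˡ-zero : Absorbsˡ 0
  absorbsˡ-zero .0 z≤n = s-idem 0

  absorbsʳ-zero : Absorbsʳ 0
  absorbsʳ-zero .0 z≤n = s-idem 0

  absorbsˡ-suc : ∀ {k} → Absorbsˡ k → (∀ r → (s (suc k) ∷ Pword (suc k) ++ r) ≈H (Pword (suc k) ++ r)) →
                 Absorbsˡ (suc k)
  absorbsˡ-suc {k} ab top j j≤1+k r with m≤n⇒m<n∨m≡n j≤1+k
  ... | inj₂ refl        = top r
  ... | inj₁ (s≤s j≤k) = begin
    s j ∷ Pword (suc k) ++ r                  ≡⟨ cong (s j ∷_) (Pword-suc k r) ⟩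
    s j ∷ Pword k ++ s (suc k) ∷ Pword k ++ r ≈⟨ ab j j≤k _ ⟩
    Pword k ++ s (suc k) ∷ Pword k ++ r       ≡⟨ Pword-suc k r ⟨
    Pword (suc k) ++ r                        ∎

  absorbsʳ-suc : ∀ {k} → Absorbsʳ k → (∀ r → (Pword (suc k) ++ s (suc k) ∷ r) ≈H (Pword (suc k) ++ r)) →
                 Absorbsʳ (suc k)
  absorbsʳ-suc {k} ab top j j≤1+k r with m≤n⇒m<n∨m≡n j≤1+k
  ... | inj₂ refl        = top r
  ... | inj₁ (s≤s j≤k) = begin
    Pword (suc k) ++ s j ∷ r                  ≡⟨ Pword-suc k _ ⟩
    Pword k ++ s (suc k) ∷ Pword k ++ s j ∷ r ≈⟨ Cong-++ˡ (Pword k) (Cong-∷ _ (ab j j≤k r)) ⟩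
    Pword k ++ s (suc k) ∷ Pword k ++ r       ≡⟨ Pword-suc k r ⟨
    Pword (suc k) ++ r                        ∎

  module _ (k : ℕ) (2+k≤m : suc (suc k) ≤ m) where

    private
      q = Pword k
      a = s (suc k)
      b = s (suc (suc k))

    Pword-suc-suc : ∀ r → Pword (suc (suc k)) ++ r ≡ q ++ a ∷ q ++ b ∷ q ++ a ∷ q ++ r
    Pword-suc-suc r =
      trans (Pword-suc (suc k) r) (trans (Pword-suc k _) (cong (λ w → q ++ a ∷ q ++ b ∷ w) (Pword-suc k r)))

    b-comm-Pword : ∀ r → (b ∷ q ++ r) ≈H (q ++ b ∷ r)
    b-comm-Pword = s-comm-Pword k (suc (suc k)) 2+k≤m ≤-refl

    aba≈bab : ∀ r → (a ∷ b ∷ a ∷ r) ≈H (b ∷ a ∷ b ∷ r)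
    aba≈bab r = Cong-++ʳ r (s-braid (suc k) (s≤s z≤n) 2+k≤m)

    Pword-merge : Absorbsˡ k → ∀ r → (q ++ a ∷ q ++ b ∷ q ++ a ∷ q ++ r) ≈H (q ++ a ∷ q ++ b ∷ a ∷ q ++ r)
    Pword-merge ab r = begin
      q ++ a ∷ q ++ b ∷ q ++ a ∷ q ++ r ≈⟨ Cong-++ˡ q (Cong-∷ a (Cong-++ˡ q (b-comm-Pword _))) ⟩
      q ++ a ∷ q ++ q ++ b ∷ a ∷ q ++ r ≈⟨ Cong-++ˡ q (Cong-∷ a (Pword-absorbsˡ ab k ≤-refl _)) ⟩
      q ++ a ∷ q ++ b ∷ a ∷ q ++ r      ∎

    absorbsˡ-top : Absorbsˡ k → Absorbsˡ (suc k) →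
                   ∀ r → (b ∷ Pword (suc (suc k)) ++ r) ≈H (Pword (suc (suc k)) ++ r)
    absorbsˡ-top abk abk+1 r = begin
      b ∷ Pword (suc (suc k)) ++ r          ≡⟨ cong (b ∷_) (Pword-suc-suc r) ⟩
      b ∷ q ++ a ∷ q ++ b ∷ q ++ a ∷ q ++ r ≈⟨ b-comm-Pword _ ⟩
      q ++ b ∷ a ∷ q ++ b ∷ q ++ a ∷ q ++ r ≈⟨ Cong-++ˡ q (Cong-∷ b (Cong-∷ a (b-comm-Pword _))) ⟨
      q ++ b ∷ a ∷ b ∷ q ++ q ++ a ∷ q ++ r ≈⟨ Cong-++ˡ q (Cong-∷ b (Cong-∷ a (Cong-∷ b (Pword-absorbsˡ abk k ≤-refl _)))) ⟩
      q ++ b ∷ a ∷ b ∷ q ++ a ∷ q ++ r      ≈⟨ Cong-++ˡ q (aba≈bab _) ⟨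
      q ++ a ∷ b ∷ a ∷ q ++ a ∷ q ++ r      ≈⟨ Cong-++ˡ q (Cong-∷ a (Cong-∷ b a-absorbed)) ⟩
      q ++ a ∷ b ∷ q ++ a ∷ q ++ r          ≈⟨ Cong-++ˡ q (Cong-∷ a (b-comm-Pword _)) ⟩
      q ++ a ∷ q ++ b ∷ a ∷ q ++ r          ≈⟨ Pword-merge abk r ⟨
      q ++ a ∷ q ++ b ∷ q ++ a ∷ q ++ r     ≡⟨ Pword-suc-suc r ⟨
      Pword (suc (suc k)) ++ r              ∎
      where
      a-absorbed : (a ∷ q ++ a ∷ q ++ r) ≈H (q ++ a ∷ q ++ r)
      a-absorbed = begin
        a ∷ q ++ a ∷ q ++ r      ≡⟨ cong (a ∷_) (Pword-suc k r) ⟨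
        a ∷ Pword (suc k) ++ r   ≈⟨ abk+1 (suc k) ≤-refl r ⟩
        Pword (suc k) ++ r       ≡⟨ Pword-suc k r ⟩
        q ++ a ∷ q ++ r          ∎

    absorbsʳ-top : Absorbsˡ k → Absorbsʳ (suc k) →
                   ∀ r → (Pword (suc (suc k)) ++ b ∷ r) ≈H (Pword (suc (suc k)) ++ r)
    absorbsʳ-top abk abk+1 r = begin
      Pword (suc (suc k)) ++ b ∷ r          ≡⟨ Pword-suc-suc (b ∷ r) ⟩
      q ++ a ∷ q ++ b ∷ q ++ a ∷ q ++ b ∷ r ≈⟨ Cong-++ˡ q (Cong-∷ a (Cong-++ˡ q (Cong-∷ b (Cong-++ˡ q (Cong-∷ a (b-comm-Pword r)))))) ⟨
      q ++ a ∷ q ++ b ∷ q ++ a ∷ b ∷ q ++ r ≈⟨ Cong-++ˡ q (Cong-∷ a (Cong-++ˡ q (b-comm-Pword _))) ⟩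
      q ++ a ∷ q ++ q ++ b ∷ a ∷ b ∷ q ++ r ≈⟨ Cong-++ˡ q (Cong-∷ a (Pword-absorbsˡ abk k ≤-refl _)) ⟩
      q ++ a ∷ q ++ b ∷ a ∷ b ∷ q ++ r      ≈⟨ Cong-++ˡ q (Cong-∷ a (Cong-++ˡ q (aba≈bab _))) ⟨
      q ++ a ∷ q ++ a ∷ b ∷ a ∷ q ++ r      ≡⟨ Pword-suc k _ ⟨
      Pword (suc k) ++ a ∷ b ∷ a ∷ q ++ r   ≈⟨ abk+1 (suc k) ≤-refl _ ⟩
      Pword (suc k) ++ b ∷ a ∷ q ++ r       ≡⟨ Pword-suc k _ ⟩
      q ++ a ∷ q ++ b ∷ a ∷ q ++ r          ≈⟨ Pword-merge abk r ⟨
      q ++ a ∷ q ++ b ∷ q ++ a ∷ q ++ r     ≡⟨ Pword-suc-suc r ⟨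
      Pword (suc (suc k)) ++ r              ∎

  absorbsˡ : ∀ k → k ≤ m → Absorbsˡ k
  absorbsˡ zero          _   = absorbsˡ-zero
  absorbsˡ (suc zero)    1≤m =
    absorbsˡ-suc absorbsˡ-zero λ r → Cong-++ʳ r (rel (rel01a _ _ refl (toℕ-clamp m 1 1≤m)))
  absorbsˡ (suc (suc k)) h   =
    absorbsˡ-suc (absorbsˡ (suc k) (<⇒≤ h))
                 (absorbsˡ-top k h (absorbsˡ k (<⇒≤ (<⇒≤ h))) (absorbsˡ (suc k) (<⇒≤ h)))

  absorbsʳ : ∀ k → k ≤ m → Absorbsʳ k
  absorbsʳ zero          _   = absorbsʳ-zero
  absorbsʳ (suc zero)    1≤m =
    absorbsʳ-suc absorbsʳ-zero λ r → c-sym (Cong-++ʳ r (rel (rel01b _ _ refl (toℕ-clamp m 1 1≤m))))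
  absorbsʳ (suc (suc k)) h   =
    absorbsʳ-suc (absorbsʳ (suc k) (<⇒≤ h))
                 (absorbsʳ-top k h (absorbsˡ k (<⇒≤ (<⇒≤ h))) (absorbsʳ (suc k) (<⇒≤ h)))

φ-σ-suc : ∀ {m} (x : Fin (suc m)) n → toℕ x ≡ suc n → Σ (Fin m) (λ y → (φ (σ x) ≡ π y) × (toℕ y ≡ n))
φ-σ-suc (fsuc y) n e = y , refl , suc-injective e

module Translation (m : ℕ) where

  open Pwords m
  private
    module G = CongReasoning (RelG m)
    module H = CongReasoning (RelH m)

  ψ : GenG m → List (GenH m)
  ψ (π k) = [ σ (fsuc k) ]
  ψ (P i) = Pword (toℕ i)

  ψ* : List (GenG m) → List (GenH m)
  ψ* = concatMap ψ

  s-toℕ : ∀ (x : Fin (suc m)) → s (toℕ x) ≡ σ x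
  s-toℕ x = cong σ (clamp-toℕ m x)

  ψ*-resp-RelG : ∀ {u v} → RelG m u v → ψ* u ≈H ψ* v
  ψ*-resp-RelG (π-idem i)         = rel (idem _)
  ψ*-resp-RelG (π-braid i j eq)   = rel (braid (fsuc i) (fsuc j) (s≤s z≤n) (cong suc eq))
  ψ*-resp-RelG (π-comm i j h)     = rel (comm (fsuc i) (fsuc j) h)
  ψ*-resp-RelG (P-idem i)         = Pword-absorbsˡ (absorbsˡ _ (toℕ≤pred[n] i)) (toℕ i) ≤-refl []
  ψ*-resp-RelG (P-comm i j) with ≤-total (toℕ i) (toℕ j)
  ... | inj₁ i≤j = c-trans (Pword-absorbsˡ (absorbsˡ _ (toℕ≤pred[n] j)) (toℕ i) i≤j [])
                           (c-sym (Pword-absorbsʳ (absorbsʳ _ (toℕ≤pred[n] j)) (toℕ i) i≤j []))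
  ... | inj₂ j≤i = c-trans (Pword-absorbsʳ (absorbsʳ _ (toℕ≤pred[n] i)) (toℕ j) j≤i [])
                           (c-sym (Pword-absorbsˡ (absorbsˡ _ (toℕ≤pred[n] i)) (toℕ j) j≤i []))
  ψ*-resp-RelG (Pπ-comm i j i<j) =
    subst (λ x → (Pword (toℕ i) ++ [ x ]) ≈H (x ∷ Pword (toℕ i) ++ [])) (s-toℕ (fsuc j))
      (c-sym (s-comm-Pword (toℕ i) (suc (toℕ j)) (toℕ≤pred[n] (fsuc j)) (s≤s i<j) []))
  ψ*-resp-RelG (Pπ-absl i j j<i) =
    subst (λ x → (Pword (toℕ i) ++ [ x ]) ≈H (Pword (toℕ i) ++ [])) (s-toℕ (fsuc j))
      (absorbsʳ _ (toℕ≤pred[n] i) (suc (toℕ j)) j<i [])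
  ψ*-resp-RelG (πP-absr i j j<i) =
    subst (λ x → (x ∷ Pword (toℕ i) ++ []) ≈H (Pword (toℕ i) ++ [])) (s-toℕ (fsuc j))
      (absorbsˡ _ (toℕ≤pred[n] i) (suc (toℕ j)) j<i [])
  ψ*-resp-RelG (P-step i i′ j i′≡1+i j≡i) = H.≡⇒Cong (begin
    Pword (toℕ i′) ++ []                      ≡⟨ cong (λ n → Pword n ++ []) i′≡1+i ⟩
    Pword (suc (toℕ i)) ++ []                 ≡⟨ Pword-suc (toℕ i) [] ⟩
    q ++ s (suc (toℕ i)) ∷ q ++ []            ≡⟨ cong (λ x → q ++ x ∷ q ++ []) s[1+i]≡σ[1+j] ⟩
    q ++ σ (fsuc j) ∷ q ++ []                 ∎)
    where
    open ≡-Reasoning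
    q : List (GenH m)
    q = Pword (toℕ i)
    s[1+i]≡σ[1+j] : s (suc (toℕ i)) ≡ σ (fsuc j)
    s[1+i]≡σ[1+j] = trans (cong (s ∘ suc) (sym j≡i)) (s-toℕ (fsuc j))

  ψ*-φ* : ∀ u → ψ* (φ* u) ≡ u
  ψ*-φ* u = trans (concatMap-map ψ φ u) (trans (concatMap-cong ψφ≗[_] u) (concatMap-pure u))
    where
    ψφ≗[_] : ∀ x → ψ (φ x) ≡ [ x ]
    ψφ≗[_] (σ fzero)    = refl
    ψφ≗[_] (σ (fsuc k)) = refl

  φ*-Pword : ∀ a → a ≤ m → φ* (Pword a) ≈G [ P (clamp m a) ]
  φ*-Pword zero    _   = c-refl
  φ*-Pword (suc a) a<m with φ-σ-suc (clamp m (suc a)) a (toℕ-clamp m (suc a) a<m)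
  ... | y , φσ≡πy , toℕy≡a = begin
    φ* (Pword a ++ s (suc a) ∷ Pword a)           ≡⟨ map-++ φ (Pword a) _ ⟩
    φ* (Pword a) ++ φ (s (suc a)) ∷ φ* (Pword a)  ≈⟨ Cong-++ (φ*-Pword a a≤m) (Cong-∷ _ (φ*-Pword a a≤m)) ⟩
    P (clamp m a) ∷ φ (s (suc a)) ∷ [ P (clamp m a) ]
      ≡⟨ cong (λ x → P (clamp m a) ∷ x ∷ [ P (clamp m a) ]) φσ≡πy ⟩
    P (clamp m a) ∷ π y ∷ [ P (clamp m a) ]
      ≈⟨ rel (P-step (clamp m a) (clamp m (suc a)) y toℕ-1+a≡ toℕy≡) ⟨
    [ P (clamp m (suc a)) ]                       ∎
    where
    open G
    a≤m : a ≤ m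
    a≤m = <⇒≤ a<m
    toℕ-1+a≡ : toℕ (clamp m (suc a)) ≡ suc (toℕ (clamp m a))
    toℕ-1+a≡ = trans (toℕ-clamp m (suc a) a<m) (cong suc (sym (toℕ-clamp m a a≤m)))
    toℕy≡ : toℕ y ≡ toℕ (clamp m a)
    toℕy≡ = trans toℕy≡a (sym (toℕ-clamp m a a≤m))

  φ*-ψ : ∀ x → [ x ] ≈G φ* (ψ x)
  φ*-ψ (π k) = c-refl
  φ*-ψ (P i) =
    subst (λ j → [ P j ] ≈G φ* (Pword (toℕ i))) (clamp-toℕ m i) (c-sym (φ*-Pword (toℕ i) (toℕ≤pred[n] i)))

  φ*-ψ* : ∀ w → w ≈G φ* (ψ* w)
  φ*-ψ* []      = c-refl
  φ*-ψ* (x ∷ w) = c-trans (G.Cong-++ (φ*-ψ x) (φ*-ψ* w)) (G.≡⇒Cong (sym (map-++ φ (ψ x) (ψ* w))))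

  P₂-step : ∀ (o : Fin m) → toℕ (fsuc o) ≡ 1 → [ P (fsuc o) ] ≈G (P fzero ∷ π o ∷ [ P fzero ])
  P₂-step o e = rel (P-step fzero (fsuc o) o e (suc-injective e))

  φ*-resp-RelH : ∀ {u v} → RelH m u v → φ* u ≈G φ* v
  φ*-resp-RelH (idem fzero)                       = rel (P-idem fzero)
  φ*-resp-RelH (idem (fsuc k))                    = rel (π-idem k)
  φ*-resp-RelH (braid (fsuc i) (fsuc j) _ eq)     = rel (π-braid i j (suc-injective eq))
  φ*-resp-RelH (rel01a fzero (fsuc o) _ toℕo≡1)   = begin
    π o ∷ P fzero ∷ π o ∷ [ P fzero ] ≈⟨ G.Cong-∷ (π o) (P₂-step o toℕo≡1) ⟨
    π o ∷ [ P (fsuc o) ]              ≈⟨ rel (πP-absr (fsuc o) o ≤-refl) ⟩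
    [ P (fsuc o) ]                    ≈⟨ P₂-step o toℕo≡1 ⟩
    P fzero ∷ π o ∷ [ P fzero ]       ∎
    where open G
  φ*-resp-RelH (rel01b fzero (fsuc o) _ toℕo≡1)   = begin
    P fzero ∷ π o ∷ [ P fzero ]       ≈⟨ P₂-step o toℕo≡1 ⟨
    [ P (fsuc o) ]                    ≈⟨ rel (Pπ-absl (fsuc o) o ≤-refl) ⟨
    P (fsuc o) ∷ [ π o ]              ≈⟨ G.Cong-++ʳ [ π o ] (P₂-step o toℕo≡1) ⟩
    P fzero ∷ π o ∷ P fzero ∷ [ π o ] ∎
    where open G
  φ*-resp-RelH (comm fzero    (fsuc j) h)         = rel (Pπ-comm fzero j (≤-pred h))
  φ*-resp-RelH (comm (fsuc i) fzero    h)         = c-sym (rel (Pπ-comm fzero i (≤-pred h)))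
  φ*-resp-RelH (comm (fsuc i) (fsuc j) h)         = rel (π-comm i j h)

corollary3p6 : (m : ℕ) →
    ((w : List (GenG m)) → Σ (List (GenH m)) (λ v → w ≈G φ* v))
    × ((u v : List (GenH m)) → (φ* u ≈G φ* v → u ≈H v) × (u ≈H v → φ* u ≈G φ* v))
corollary3p6 m = generated , λ u v → reflects u v , Cong-map φ* (map-++ φ) φ*-resp-RelH
  where
  open Translation m

  generated : (w : List (GenG m)) → Σ (List (GenH m)) (λ v → w ≈G φ* v)
  generated w = ψ* w , φ*-ψ* w

  reflects : (u v : List (GenH m)) → φ* u ≈G φ* v → u ≈H v
  reflects u v p = subst₂ _≈H_ (ψ*-φ* u) (ψ*-φ* v) (Cong-map ψ* (concatMap-++ ψ) ψ*-resp-RelG p)
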